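{- Let $\delta\ge3$ and let $\overrightarrow{\mathcal K}$ be a Ramsey class whose members are either all ordered metric spaces with distances in $\{1,\dots,\delta-1\}$, or all ordered metric spaces with distances in $\{1,\dots,\delta-1\}$ equipped with a unary predicate $B$ determining the bipartition. Then the class $\overrightarrow{\mathcal K}^\ominus=\{\overrightarrow{\mathbf M}^\ominus:\overrightarrow{\mathbf M}\in\overrightarrow{\mathcal K}\}$ of all antipodal expansions of members of $\overrightarrow{\mathcal K}$ is Ramsey.
   Context: For $\mathbf M=(M,d)$ with distances at most $\delta-1$, its antipodal extension is $\mathbf M^\ominus=(M\times\{0,1\},d')$ with $d'((u,i),(v,i))=d(u,v)$ and $d'((u,i),(v,1-i))=\delta-d(u,v)$ for $u,v\in M$, $i\in\{0,1\}$ (so $d'((u,0),(u,1))=\delta$). For an ordered space $\overrightarrow{\mathbf M}=(M,d,\le)$, $\overrightarrow{\mathbf M}^\ominus$ is $\mathbf M^\ominus$ with order $(u,i)\le(v,j)$ iff $i<j$, or $i=j$ and $u\le v$. For an ordered bipartite space $(M,d,\le,B)$, where $B$ is a unary predicate such that $d(u,v)$ is even iff $u,v$ are both in $B$ or both outside $B$, the antipodal extension additionally has the predicate $B^\ominus$ with $(v,0)\in B^\ominus$ iff $v\in B$, and $(v,1)\in B^\ominus$ iff $v\in B$ when $\delta$ is even, iff $v\notin B$ when $\delta$ is odd. A class $\mathcal C$ is Ramsey if for all $\mathbf A,\mathbf B\in\mathcal C$ and $k\ge1$ there is $\mathbf C\in\mathcal C$ such that for every $k$-colouring of the substructures of $\mathbf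 C$ isomorphic to $\mathbf A$ some substructure of $\mathbf C$ isomorphic to $\mathbf B$ has all its copies of $\mathbf A$ of one colour. -}

module Defs where

open import Data.Nat using (ℕ; zero; suc; _+_; _∸_; _≤_; _<_)
open import Data.Nat.Divisibility using (_∣_)
open import Data.Fin as F using (Fin; splitAt)
open import Data.Fin.Properties using (any?)
open import Data.Fin.Subset using (Subset; _⊆_)
open import Data.Vec using (tabulate)
open import Data.Bool using (Bool; not; if_then_else_)
open import Data.Sum using (_⊎_; inj₁; inj₂)
open import Data.Product using (Σ; Σ-syntax; ∃; ∃-syntax; _×_; _,_)
open import Relation.Nullary using (¬_; does)
open import Relation.Nullary.Decidable using (⌊_⌋)
open import Relation.Binary.PropositionalEquality using (_≡_; _≢_)
open import Function.Bundles using (_⇔_)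

-- Generic Ramsey property for classes of finite structures on carriers
-- Fin n, where an embedding A → B is an isomorphism of A onto the
-- induced substructure of B on its image.  A "substructure of C
-- isomorphic to A" (a copy of A) is the image of an embedding A → C.

module Generic {S : Set} (size : S → ℕ) (Emb : S → S → Set)
               (emb : ∀ {A B} → Emb A B → Fin (size A) → Fin (size B)) where

  image : ∀ {A C} → Emb A C → Subset (size C)
  image {A} f = tabulate λ j → does (any? {n = size A} λ i → emb f i F.≟ j)

  Iso : S → S → Set
  Iso A B = Σ[ e ∈ Emb A B ] Σ[ h ∈ (Fin (size B) → Fin (size A)) ]
              (∀ x → emb e (h x) ≡ x)

  Ramsey : (S → Set) → Set
  Ramsey 𝒞 = ∀ A B → 𝒞 A → 𝒞 B → (k : ℕ) → 1 ≤ k →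
    Σ[ C ∈ S ] (𝒞 C ×
      ((χ : Subset (size C) → Fin k) →
        Σ[ g ∈ Emb B C ] Σ[ i ∈ Fin k ]
          ((f : Emb A C) → image f ⊆ image g → χ (image f) ≡ i)))

-- Ordered (distance) spaces: carrier Fin n, order = the natural order of Fin n.

record OSpace : Set where
  constructor ospace
  field
    size : ℕ
    d    : Fin size → Fin size → ℕ
open OSpace public

record OEmb (A C : OSpace) : Set where
  field
    map   : Fin (size A) → Fin (size C)
    mono  : ∀ u v → u F.< v → map u F.< map v
    pres  : ∀ u v → d C (map u) (map v) ≡ d A u v
open OEmb public

IsMetricδ : ℕ → OSpace → Set
IsMetricδ δ M =
    (∀ u → d M u u ≡ 0)
  × (∀ u v → u ≢ v → 1 ≤ d M u v × d M u v ≤ δ ∸ 1)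
  × (∀ u v → d M u v ≡ d M v u)
  × (∀ u v w → d M u w ≤ d M u v + d M v w)

-- antipodal extension: (u,0) ↦ inject u, (u,1) ↦ raise u in Fin (n + n);
-- the natural order on Fin (n + n) is exactly the lexicographic order
-- (i < j, or i = j and u ≤ v) of the paper.
antiD : (δ n : ℕ) → (Fin n → Fin n → ℕ) → Fin (n + n) → Fin (n + n) → ℕ
antiD δ n d x y with splitAt n x | splitAt n y
... | inj₁ u | inj₁ v = d u v
... | inj₂ u | inj₂ v = d u v
... | inj₁ u | inj₂ v = δ ∸ d u v
... | inj₂ u | inj₁ v = δ ∸ d u v

antipodal : ℕ → OSpace → OSpace
antipodal δ M = ospace (size M + size M) (antiD δ (size M) (d M))

module OG = Generic size OEmb map

RamseyO : (OSpace → Set) → Set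
RamseyO = OG.Ramsey

AntiClassO : ℕ → (OSpace → Set) → OSpace → Set
AntiClassO δ 𝒦 N = Σ[ M ∈ OSpace ] (𝒦 M × OG.Iso N (antipodal δ M))

record BSpace : Set where
  constructor bspace
  field
    sp : OSpace
    B  : Fin (size sp) → Bool
open BSpace public

bsize : BSpace → ℕ
bsize M = size (sp M)

record BEmb (A C : BSpace) : Set where
  field
    oemb  : OEmb (sp A) (sp C)
    presB : ∀ u → B C (map oemb u) ≡ B A u
open BEmb public

Even : ℕ → Set
Even n = 2 ∣ n

IsBipMetricδ : ℕ → BSpace → Set
IsBipMetricδ δ M = IsMetricδ δ (sp M)
  × (∀ u v → Even (d (sp M) u v) ⇔ (B M u ≡ B M v))

antiB : (δ n : ℕ) → (Fin n → Bool) → Fin (n + n) → Bool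
antiB δ n b x with splitAt n x
... | inj₁ v = b v
... | inj₂ v = if ⌊ Data.Nat.Divisibility._∣?_ 2 δ ⌋ then b v else not (b v)

antipodalB : ℕ → BSpace → BSpace
antipodalB δ M = bspace (antipodal δ (sp M)) (antiB δ (bsize M) (B M))

module BG = Generic bsize BEmb (λ e → map (oemb e))

RamseyB : (BSpace → Set) → Set
RamseyB = BG.Ramsey

AntiClassB : ℕ → (BSpace → Set) → BSpace → Set
AntiClassB δ 𝒦 N = Σ[ M ∈ BSpace ] (𝒦 M × BG.Iso N (antipodalB δ M))

-- Distance δ occurs in an antipodal extension exactly between the two copies (u,0), (u,1) of a
-- point, so an embedding of M^⊖ into C^⊖ sends antipodal pairs to antipodal pairs and, being
-- order preserving, the copy M×{0} into C×{0}; it is therefore the antipodal extension φ^⊖ of an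
-- embedding φ : M → C, and its image is the doubled image of φ. Hence a colouring χ of the
-- copies of A = M^⊖ in C^⊖ induces the colouring S ↦ χ(S×{0,1}) of the copies of M in C, and a
-- copy of N homogeneous for the latter doubles to a copy of N^⊖ homogeneous for χ.
module Submission where

open import Defs
open import Data.Nat as ℕ using (ℕ; zero; suc; _+_; _∸_; _≤_; s≤s; z≤n)
import Data.Nat.Properties as ℕ
open import Data.Bool using (Bool)
open import Data.Empty using (⊥-elim)
open import Data.Fin as F using (Fin; splitAt; join; _↑ˡ_; _↑ʳ_; toℕ)
open import Data.Fin.Properties using (any?; toℕ<n; toℕ-↑ˡ; toℕ-↑ʳ; splitAt-↑ˡ; splitAt-↑ʳ; splitAt⁻¹-↑ˡ; splitAt⁻¹-↑ʳ; <-cmp)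
open import Data.Fin.Subset using (Subset; _∈_; _⊆_)
open import Data.Fin.Subset.Properties using (⊆-antisym; ⊆-trans; ⊆-reflexive)
open import Data.Vec using (tabulate; _++_)
open import Data.Vec.Properties using (lookup∘tabulate; lookup-++ˡ; lookup-++ʳ; []=⇒lookup; lookup⇒[]=)
open import Data.Sum as Sum using (inj₁; inj₂)
open import Data.Product using (Σ-syntax; ∃; _×_; _,_; proj₁; proj₂)
open import Relation.Nullary using (¬_; does; yes; no)
open import Relation.Nullary.Decidable using (dec-true)
open import Relation.Binary using (tri<; tri≈; tri>)
open import Relation.Binary.PropositionalEquality
open import Function using (_∘_; id)

private
  variable
    a b c m n : ℕ

-- Definitionally equal to Generic.image e for e an embedding with underlying map g.
img : (Fin a → Fin c) → Subset c
img {a} g = tabulate λ x → does (any? {n = a} λ i → g i F.≟ x)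

∈-img : (g : Fin a → Fin c) (i : Fin a) → g i ∈ img g
∈-img g i = lookup⇒[]= (g i) (img g)
  (trans (lookup∘tabulate _ (g i)) (dec-true (any? λ j → g j F.≟ g i) (i , refl)))

img-preimage : (g : Fin a → Fin c) {x : Fin c} → x ∈ img g → ∃ λ i → g i ≡ x
img-preimage {a} g {x} x∈ with any? {n = a} (λ i → g i F.≟ x)
                            | trans (sym (lookup∘tabulate _ x)) ([]=⇒lookup x∈)
... | yes w | _ = w
... | no _  | ()

img-⊆ : (g : Fin a → Fin c) (h : Fin b → Fin c) → (∀ i → ∃ λ j → g i ≡ h j) → img g ⊆ img h
img-⊆ g h factor x∈ with img-preimage g x∈
... | i , refl with factor i
...   | j , gi≡hj = subst (_∈ img h) (sym gi≡hj) (∈-img h j)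

img-cong : {g h : Fin a → Fin c} → (∀ i → g i ≡ h i) → img g ≡ img h
img-cong {g = g} {h} g≗h =
  ⊆-antisym (img-⊆ g h λ i → i , g≗h i) (img-⊆ h g λ i → i , sym (g≗h i))

img-∘-⊆ : (g : Fin b → Fin c) (h : Fin a → Fin b) → img (g ∘ h) ⊆ img g
img-∘-⊆ g h = img-⊆ (g ∘ h) g λ i → h i , refl

img-∘-retraction : (g : Fin b → Fin c) {h : Fin a → Fin b} {s : Fin b → Fin a} →
                   (∀ j → h (s j) ≡ j) → img (g ∘ h) ≡ img g
img-∘-retraction g {h} {s} h∘s≗id =
  ⊆-antisym (img-∘-⊆ g h) (img-⊆ g (g ∘ h) λ j → s j , cong g (sym (h∘s≗id j)))

data Halves (m n : ℕ) : Fin (m + n) → Set where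
  left  : (u : Fin m) → Halves m n (u ↑ˡ n)
  right : (v : Fin n) → Halves m n (m ↑ʳ v)

halves : ∀ m n (x : Fin (m + n)) → Halves m n x
halves m n x with splitAt m x in eq
... | inj₁ u = subst (Halves m n) (splitAt⁻¹-↑ˡ eq) (left u)
... | inj₂ v = subst (Halves m n) (splitAt⁻¹-↑ʳ eq) (right v)

↑ˡ-mono-< : {u v : Fin m} → u F.< v → u ↑ˡ n F.< v ↑ˡ n
↑ˡ-mono-< {n = n} {u} {v} = subst₂ ℕ._<_ (sym (toℕ-↑ˡ u n)) (sym (toℕ-↑ˡ v n))

↑ˡ-cancel-< : {u v : Fin m} → u ↑ˡ n F.< v ↑ˡ n → u F.< v
↑ˡ-cancel-< {n = n} {u} {v} = subst₂ ℕ._<_ (toℕ-↑ˡ u n) (toℕ-↑ˡ v n)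

↑ʳ-mono-< : {u v : Fin n} → u F.< v → m ↑ʳ u F.< m ↑ʳ v
↑ʳ-mono-< {m = m} {u} {v} u<v =
  subst₂ ℕ._<_ (sym (toℕ-↑ʳ m u)) (sym (toℕ-↑ʳ m v)) (ℕ.+-monoʳ-< m u<v)

↑ʳ-cancel-< : {u v : Fin n} → m ↑ʳ u F.< m ↑ʳ v → u F.< v
↑ʳ-cancel-< {m = m} {u} {v} p =
  ℕ.+-cancelˡ-< m (toℕ u) (toℕ v) (subst₂ ℕ._<_ (toℕ-↑ʳ m u) (toℕ-↑ʳ m v) p)

↑ˡ<↑ʳ : (u : Fin m) (v : Fin n) → u ↑ˡ n F.< m ↑ʳ v
↑ˡ<↑ʳ {m} {n} u v = subst₂ ℕ._<_ (sym (toℕ-↑ˡ u n)) (sym (toℕ-↑ʳ m v))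
  (ℕ.<-≤-trans (toℕ<n u) (ℕ.m≤m+n m (toℕ v)))

↑ʳ≮↑ˡ : (u : Fin m) (v : Fin n) → ¬ (m ↑ʳ v F.< u ↑ˡ n)
↑ʳ≮↑ˡ u v p = ℕ.<-asym p (↑ˡ<↑ʳ u v)

double : Subset n → Subset (n + n)
double S = S ++ S

∈-double-↑ˡ : {S : Subset n} {u : Fin n} → u ∈ S → u ↑ˡ n ∈ double S
∈-double-↑ˡ {S = S} {u} u∈S = lookup⇒[]= _ (double S) (trans (lookup-++ˡ S S u) ([]=⇒lookup u∈S))

∈-double-↑ʳ : {S : Subset n} {u : Fin n} → u ∈ S → n ↑ʳ u ∈ double S
∈-double-↑ʳ {S = S} {u} u∈S = lookup⇒[]= _ (double S) (trans (lookup-++ʳ S S u) ([]=⇒lookup u∈S))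

double-↑ˡ-∈ : {S : Subset n} {u : Fin n} → u ↑ˡ n ∈ double S → u ∈ S
double-↑ˡ-∈ {S = S} {u} p = lookup⇒[]= u S (trans (sym (lookup-++ˡ S S u)) ([]=⇒lookup p))

double-↑ʳ-∈ : {S : Subset n} {u : Fin n} → n ↑ʳ u ∈ double S → u ∈ S
double-↑ʳ-∈ {S = S} {u} p = lookup⇒[]= u S (trans (sym (lookup-++ʳ S S u)) ([]=⇒lookup p))

double-reflects-⊆ : {S T : Subset n} → double S ⊆ double T → S ⊆ T
double-reflects-⊆ S²⊆T² u∈S = double-↑ˡ-∈ (S²⊆T² (∈-double-↑ˡ u∈S))

antipodalMap : (Fin m → Fin c) → Fin (m + m) → Fin (c + c)
antipodalMap {m} {c} g = join c c ∘ Sum.map g g ∘ splitAt m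

antipodalMap-↑ˡ : (g : Fin m → Fin c) (u : Fin m) → antipodalMap g (u ↑ˡ m) ≡ g u ↑ˡ c
antipodalMap-↑ˡ {m} g u rewrite splitAt-↑ˡ m u m = refl

antipodalMap-↑ʳ : (g : Fin m → Fin c) (u : Fin m) → antipodalMap g (m ↑ʳ u) ≡ c ↑ʳ g u
antipodalMap-↑ʳ {m} g u rewrite splitAt-↑ʳ m m u = refl

img-antipodalMap : (g : Fin m → Fin c) → img (antipodalMap g) ≡ double (img g)
img-antipodalMap {m} {c} g = ⊆-antisym ⊆-double ⊇-double
  where
  ⊆-double : img (antipodalMap g) ⊆ double (img g)
  ⊆-double x∈ with img-preimage (antipodalMap g) x∈
  ... | y , refl with halves m m y
  ...   | left u  rewrite antipodalMap-↑ˡ g u = ∈-double-↑ˡ (∈-img g u)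
  ...   | right u rewrite antipodalMap-↑ʳ g u = ∈-double-↑ʳ (∈-img g u)
  ⊇-double : double (img g) ⊆ img (antipodalMap g)
  ⊇-double {x} x∈ with halves c c x
  ... | left w with img-preimage g (double-↑ˡ-∈ x∈)
  ...   | u , refl = subst (_∈ img (antipodalMap g)) (antipodalMap-↑ˡ g u) (∈-img _ (u ↑ˡ m))
  ⊇-double x∈ | right w with img-preimage g (double-↑ʳ-∈ x∈)
  ...   | u , refl = subst (_∈ img (antipodalMap g)) (antipodalMap-↑ʳ g u) (∈-img _ (m ↑ʳ u))

module RamseyTransfer
  {S : Set} (size : S → ℕ) (Emb : S → S → Set)
  (emb : ∀ {A B} → Emb A B → Fin (size A) → Fin (size B))
  (_∘ᴱ_ : ∀ {A B C} → Emb B C → Emb A B → Emb A C)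
  (emb-∘ : ∀ {A B C} (g : Emb B C) (f : Emb A B) x → emb (g ∘ᴱ f) x ≡ emb g (emb f x))
  (idᴱ : ∀ {A} → Emb A A)
  (emb-id : ∀ {A} x → emb (idᴱ {A}) x ≡ x)
  (inverse : ∀ {A B} → (e : Generic.Iso size Emb emb A B) →
             Σ[ e⁻¹ ∈ Emb B A ] (∀ x → emb e⁻¹ (emb (proj₁ e) x) ≡ x))
  (anti : S → S)
  (doubleᴬ : ∀ {C} → Subset (size C) → Subset (size (anti C)))
  (doubleᴬ-reflects-⊆ : ∀ {C} {P Q : Subset (size C)} → doubleᴬ P ⊆ doubleᴬ Q → P ⊆ Q)
  (antiEmb : ∀ {M C} → Emb M C → Emb (anti M) (anti C))
  (img-antiEmb : ∀ {M C} (g : Emb M C) → img (emb (antiEmb g)) ≡ doubleᴬ (img (emb g)))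
  (Good : S → Set)
  (descent : ∀ {M C} → Good M → Good C → (F : Emb (anti M) (anti C)) →
             Σ[ φ ∈ Emb M C ] img (emb F) ≡ doubleᴬ (img (emb φ)))
  where
  open Generic size Emb emb

  AntiClass : (S → Set) → S → Set
  AntiClass 𝒦 N = Σ[ M ∈ S ] (𝒦 M × Iso N (anti M))

  image-∘ᴱ-⊆ : ∀ {A B C} (g : Emb B C) (f : Emb A B) → image (g ∘ᴱ f) ⊆ image g
  image-∘ᴱ-⊆ g f = ⊆-trans (⊆-reflexive (img-cong (emb-∘ g f))) (img-∘-⊆ (emb g) (emb f))

  image-∘ᴱ-inverse : ∀ {A B C} (f : Emb A C) (e : Iso A B) → image (f ∘ᴱ proj₁ (inverse e)) ≡ image f
  image-∘ᴱ-inverse f e =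
    trans (img-cong (emb-∘ f (proj₁ (inverse e))))
          (img-∘-retraction (emb f) {h = emb (proj₁ (inverse e))} {s = emb (proj₁ e)} (proj₂ (inverse e)))

  ramsey-antiClass : ∀ 𝒦 → (∀ M → 𝒦 M → Good M) → Ramsey 𝒦 → Ramsey (AntiClass 𝒦)
  ramsey-antiClass 𝒦 good ramsey A B (M , 𝒦M , isoA) (N , 𝒦N , (eB , _)) k k≥1
    with ramsey M N 𝒦M 𝒦N k k≥1
  ... | C , 𝒦C , partition = anti C , (C , 𝒦C , (idᴱ , id , emb-id)) , homogeneous
    where
    homogeneous : (χ : Subset (size (anti C)) → Fin k) →
      Σ[ g ∈ Emb B (anti C) ] Σ[ i ∈ Fin k ]
        ((f : Emb A (anti C)) → image f ⊆ image g → χ (image f) ≡ i)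
    homogeneous χ with partition (χ ∘ doubleᴬ)
    ... | g , i , monochromatic = antiEmb g ∘ᴱ eB , i , λ f f⊆ →
      let (φ , image-φ²) = descent (good M 𝒦M) (good C 𝒦C) (f ∘ᴱ proj₁ (inverse isoA))
          image-f : image f ≡ doubleᴬ (image φ)
          image-f = trans (sym (image-∘ᴱ-inverse f isoA)) image-φ²
          φ²⊆g² : doubleᴬ (image φ) ⊆ doubleᴬ (image g)
          φ²⊆g² = ⊆-trans (⊆-reflexive (sym image-f))
                    (⊆-trans f⊆ (⊆-trans (image-∘ᴱ-⊆ (antiEmb g) eB) (⊆-reflexive (img-antiEmb g))))
      in trans (cong χ image-f) (monochromatic φ (doubleᴬ-reflects-⊆ φ²⊆g²))

m∸n≡m⇒n≡0 : 1 ≤ m → m ∸ n ≡ m → n ≡ 0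
m∸n≡m⇒n≡0 {n = zero}          _ _ = refl
m∸n≡m⇒n≡0 {suc m} {suc n} _ eq = ⊥-elim (ℕ.<-irrefl eq (s≤s (ℕ.m∸n≤m m n)))

module _ {δ : ℕ} {M : OSpace} (metric : IsMetricδ δ M) where

  dist≡0⇒≡ : ∀ {u v} → d M u v ≡ 0 → u ≡ v
  dist≡0⇒≡ {u} {v} d≡0 with u F.≟ v
  ... | yes u≡v = u≡v
  ... | no u≢v with subst (1 ≤_) d≡0 (proj₁ (proj₁ (proj₂ metric) u v u≢v))
  ...   | ()

  dist<δ : 1 ≤ δ → ∀ u v → d M u v ℕ.< δ
  dist<δ (s≤s z≤n) u v with u F.≟ v
  ... | yes refl = subst (ℕ._< δ) (sym (proj₁ metric u)) (s≤s z≤n)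
  ... | no u≢v   = s≤s (proj₂ (proj₁ (proj₂ metric) u v u≢v))

module _ (δ n : ℕ) (dist : Fin n → Fin n → ℕ) (u v : Fin n) where

  antiD-↑ˡ↑ˡ : antiD δ n dist (u ↑ˡ n) (v ↑ˡ n) ≡ dist u v
  antiD-↑ˡ↑ˡ rewrite splitAt-↑ˡ n u n | splitAt-↑ˡ n v n = refl

  antiD-↑ˡ↑ʳ : antiD δ n dist (u ↑ˡ n) (n ↑ʳ v) ≡ δ ∸ dist u v
  antiD-↑ˡ↑ʳ rewrite splitAt-↑ˡ n u n | splitAt-↑ʳ n n v = refl

  antiD-↑ʳ↑ˡ : antiD δ n dist (n ↑ʳ u) (v ↑ˡ n) ≡ δ ∸ dist u v
  antiD-↑ʳ↑ˡ rewrite splitAt-↑ʳ n n u | splitAt-↑ˡ n v n = refl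

  antiD-↑ʳ↑ʳ : antiD δ n dist (n ↑ʳ u) (n ↑ʳ v) ≡ dist u v
  antiD-↑ʳ↑ʳ rewrite splitAt-↑ʳ n n u | splitAt-↑ʳ n n v = refl

antiB-↑ˡ : ∀ δ n (β : Fin n → Bool) u → antiB δ n β (u ↑ˡ n) ≡ β u
antiB-↑ˡ δ n β u rewrite splitAt-↑ˡ n u n = refl

antiB-↑ʳ-cong : ∀ δ {m n} (β : Fin m → Bool) (β′ : Fin n → Bool) {u v} → β u ≡ β′ v →
                antiB δ m β (m ↑ʳ u) ≡ antiB δ n β′ (n ↑ʳ v)
antiB-↑ʳ-cong δ {m} {n} β β′ {u} {v} βu≡β′v
  rewrite splitAt-↑ʳ m m u | splitAt-↑ʳ n n v | βu≡β′v = refl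

_∘ᴼ_ : ∀ {A B C} → OEmb B C → OEmb A B → OEmb A C
g ∘ᴼ f = record
  { map  = map g ∘ map f
  ; mono = λ u v u<v → mono g _ _ (mono f u v u<v)
  ; pres = λ u v → trans (pres g _ _) (pres f u v)
  }

idᴼ : ∀ {A} → OEmb A A
idᴼ = record { map = id ; mono = λ _ _ u<v → u<v ; pres = λ _ _ → refl }

map-injective : ∀ {A C} (e : OEmb A C) {u v} → map e u ≡ map e v → u ≡ v
map-injective e {u} {v} eu≡ev with <-cmp u v
... | tri< u<v _ _ = ⊥-elim (ℕ.<-irrefl (cong toℕ eu≡ev) (mono e u v u<v))
... | tri≈ _ u≡v _ = u≡v
... | tri> _ _ v<u = ⊥-elim (ℕ.<-irrefl (cong toℕ (sym eu≡ev)) (mono e v u v<u))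

inverseᴼ : ∀ {A M} → (e : OG.Iso A M) →
           Σ[ e⁻¹ ∈ OEmb M A ] (∀ u → map e⁻¹ (map (proj₁ e) u) ≡ u)
inverseᴼ {A} {M} (e , h , e∘h≗id) =
  record { map = h ; mono = h-mono ; pres = h-pres } , λ u → map-injective e (e∘h≗id (map e u))
  where
  h-mono : ∀ x y → x F.< y → h x F.< h y
  h-mono x y x<y with <-cmp (h x) (h y)
  ... | tri< hx<hy _ _ = hx<hy
  ... | tri≈ _ hx≡hy _ =
    ⊥-elim (ℕ.<-irrefl (cong toℕ (trans (sym (e∘h≗id x)) (trans (cong (map e) hx≡hy) (e∘h≗id y)))) x<y)
  ... | tri> _ _ hy<hx =
    ⊥-elim (ℕ.<-asym x<y (subst₂ F._<_ (e∘h≗id y) (e∘h≗id x) (mono e _ _ hy<hx)))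
  h-pres : ∀ x y → d A (h x) (h y) ≡ d M x y
  h-pres x y = trans (sym (pres e (h x) (h y))) (cong₂ (d M) (e∘h≗id x) (e∘h≗id y))

antipodalEmb : ∀ {δ M C} → OEmb M C → OEmb (antipodal δ M) (antipodal δ C)
antipodalEmb {δ} {M} {C} g = record { map = g² ; mono = g²-mono ; pres = g²-pres }
  where
  g² : Fin (size M + size M) → Fin (size C + size C)
  g² = antipodalMap (map g)
  g²-mono : ∀ x y → x F.< y → g² x F.< g² y
  g²-mono x y x<y with halves (size M) (size M) x | halves (size M) (size M) y
  ... | left u  | left v  rewrite antipodalMap-↑ˡ (map g) u | antipodalMap-↑ˡ (map g) v =
    ↑ˡ-mono-< (mono g u v (↑ˡ-cancel-< x<y))
  ... | left u  | right v rewrite antipodalMap-↑ˡ (map g) u | antipodalMap-↑ʳ (map g) v =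
    ↑ˡ<↑ʳ (map g u) (map g v)
  ... | right u | left v  = ⊥-elim (↑ʳ≮↑ˡ v u x<y)
  ... | right u | right v rewrite antipodalMap-↑ʳ (map g) u | antipodalMap-↑ʳ (map g) v =
    ↑ʳ-mono-< (mono g u v (↑ʳ-cancel-< x<y))
  g²-pres : ∀ x y → antiD δ (size C) (d C) (g² x) (g² y) ≡ antiD δ (size M) (d M) x y
  g²-pres x y with halves (size M) (size M) x | halves (size M) (size M) y
  ... | left u  | left v
    rewrite antipodalMap-↑ˡ (map g) u | antipodalMap-↑ˡ (map g) v
          | antiD-↑ˡ↑ˡ δ _ (d C) (map g u) (map g v) | antiD-↑ˡ↑ˡ δ _ (d M) u v = pres g u v
  ... | left u  | right v
    rewrite antipodalMap-↑ˡ (map g) u | antipodalMap-↑ʳ (map g) v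
          | antiD-↑ˡ↑ʳ δ _ (d C) (map g u) (map g v) | antiD-↑ˡ↑ʳ δ _ (d M) u v =
    cong (δ ∸_) (pres g u v)
  ... | right u | left v
    rewrite antipodalMap-↑ʳ (map g) u | antipodalMap-↑ˡ (map g) v
          | antiD-↑ʳ↑ˡ δ _ (d C) (map g u) (map g v) | antiD-↑ʳ↑ˡ δ _ (d M) u v =
    cong (δ ∸_) (pres g u v)
  ... | right u | right v
    rewrite antipodalMap-↑ʳ (map g) u | antipodalMap-↑ʳ (map g) v
          | antiD-↑ʳ↑ʳ δ _ (d C) (map g u) (map g v) | antiD-↑ʳ↑ʳ δ _ (d M) u v = pres g u v

antipodes : ∀ {δ} {C : OSpace} → IsMetricδ δ C → 1 ≤ δ →
            ∀ {x y} → x F.< y → antiD δ (size C) (d C) x y ≡ δ →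
            ∃ λ z → x ≡ z ↑ˡ size C × y ≡ size C ↑ʳ z
antipodes {δ} {C} metric δ≥1 {x} {y} x<y dxy≡δ with halves (size C) (size C) x | halves (size C) (size C) y
... | left u  | left v  =
  ⊥-elim (ℕ.<-irrefl (trans (sym (antiD-↑ˡ↑ˡ δ _ (d C) u v)) dxy≡δ) (dist<δ metric δ≥1 u v))
... | left u  | right v =
  u , refl , cong (_ ↑ʳ_) (sym u≡v)
  where
  u≡v : u ≡ v
  u≡v = dist≡0⇒≡ {δ} metric (m∸n≡m⇒n≡0 δ≥1 (trans (sym (antiD-↑ˡ↑ʳ δ _ (d C) u v)) dxy≡δ))
... | right u | left v  = ⊥-elim (↑ʳ≮↑ˡ v u x<y)
... | right u | right v =
  ⊥-elim (ℕ.<-irrefl (trans (sym (antiD-↑ʳ↑ʳ δ _ (d C) u v)) dxy≡δ) (dist<δ metric δ≥1 u v))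

module AntipodalDescent {δ} (δ≥1 : 1 ≤ δ) {M C : OSpace} (d-refl : ∀ u → d M u u ≡ 0)
                        (metric : IsMetricδ δ C) (F : OEmb (antipodal δ M) (antipodal δ C)) where

  antipodal-pair : ∀ u → ∃ λ z → map F (u ↑ˡ size M) ≡ z ↑ˡ size C
                               × map F (size M ↑ʳ u) ≡ size C ↑ʳ z
  antipodal-pair u = antipodes metric δ≥1 (mono F _ _ (↑ˡ<↑ʳ u u))
    (trans (pres F _ _) (trans (antiD-↑ˡ↑ʳ δ _ (d M) u u) (cong (δ ∸_) (d-refl u))))

  φ : Fin (size M) → Fin (size C)
  φ u = proj₁ (antipodal-pair u)

  F-↑ˡ : ∀ u → map F (u ↑ˡ size M) ≡ φ u ↑ˡ size C
  F-↑ˡ u = proj₁ (proj₂ (antipodal-pair u))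

  F≗φ² : ∀ x → map F x ≡ antipodalMap φ x
  F≗φ² x with halves (size M) (size M) x
  ... | left u  = trans (F-↑ˡ u) (sym (antipodalMap-↑ˡ φ u))
  ... | right u = trans (proj₂ (proj₂ (antipodal-pair u))) (sym (antipodalMap-↑ʳ φ u))

  descentEmb : OEmb M C
  descentEmb = record { map = φ ; mono = φ-mono ; pres = φ-pres }
    where
    φ-mono : ∀ u v → u F.< v → φ u F.< φ v
    φ-mono u v u<v = ↑ˡ-cancel-< (subst₂ F._<_ (F-↑ˡ u) (F-↑ˡ v) (mono F _ _ (↑ˡ-mono-< u<v)))
    φ-pres : ∀ u v → d C (φ u) (φ v) ≡ d M u v
    φ-pres u v = begin
      d C (φ u) (φ v)                                       ≡⟨ antiD-↑ˡ↑ˡ δ _ (d C) (φ u) (φ v) ⟨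
      antiD δ _ (d C) (φ u ↑ˡ size C) (φ v ↑ˡ size C)       ≡⟨ cong₂ (antiD δ _ (d C)) (F-↑ˡ u) (F-↑ˡ v) ⟨
      antiD δ _ (d C) (map F (u ↑ˡ _)) (map F (v ↑ˡ _))     ≡⟨ pres F _ _ ⟩
      antiD δ _ (d M) (u ↑ˡ size M) (v ↑ˡ size M)           ≡⟨ antiD-↑ˡ↑ˡ δ _ (d M) u v ⟩
      d M u v                                               ∎
      where open ≡-Reasoning

  img-descent : img (map F) ≡ double (img φ)
  img-descent = trans (img-cong F≗φ²) (img-antipodalMap φ)

descentᴼ : ∀ {δ} → 1 ≤ δ → ∀ {M C} → IsMetricδ δ M → IsMetricδ δ C →
           (F : OEmb (antipodal δ M) (antipodal δ C)) →
           Σ[ φ ∈ OEmb M C ] img (map F) ≡ double (img (map φ))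
descentᴼ δ≥1 {M} {C} metricM metricC F = descentEmb , img-descent
  where open AntipodalDescent δ≥1 {M} {C} (proj₁ metricM) metricC F

module OrderedTransfer (δ : ℕ) (δ≥1 : 1 ≤ δ) = RamseyTransfer
  size OEmb map _∘ᴼ_ (λ _ _ _ → refl) idᴼ (λ _ → refl) inverseᴼ
  (antipodal δ) double double-reflects-⊆ antipodalEmb (λ g → img-antipodalMap (map g))
  (IsMetricδ δ) (descentᴼ δ≥1)

_∘ᴮ_ : ∀ {A B C} → BEmb B C → BEmb A B → BEmb A C
g ∘ᴮ f = record { oemb = oemb g ∘ᴼ oemb f ; presB = λ u → trans (presB g _) (presB f u) }

idᴮ : ∀ {A} → BEmb A A
idᴮ = record { oemb = idᴼ ; presB = λ _ → refl }

inverseᴮ : ∀ {A M} → (e : BG.Iso A M) →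
           Σ[ e⁻¹ ∈ BEmb M A ] (∀ u → map (oemb e⁻¹) (map (oemb (proj₁ e)) u) ≡ u)
inverseᴮ {A} {M} (e , h , e∘h≗id) =
  record { oemb = proj₁ (inverseᴼ (oemb e , h , e∘h≗id))
         ; presB = λ x → trans (sym (presB e (h x))) (cong (B M) (e∘h≗id x)) }
  , proj₂ (inverseᴼ (oemb e , h , e∘h≗id))

antipodalEmbᴮ : ∀ {δ M C} → BEmb M C → BEmb (antipodalB δ M) (antipodalB δ C)
antipodalEmbᴮ {δ} {M} {C} g = record { oemb = antipodalEmb (oemb g) ; presB = g²-presB }
  where
  g²-presB : ∀ x → antiB δ (bsize C) (B C) (antipodalMap (map (oemb g)) x)
                  ≡ antiB δ (bsize M) (B M) x
  g²-presB x with halves (bsize M) (bsize M) x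
  ... | left u  rewrite antipodalMap-↑ˡ (map (oemb g)) u
                      | antiB-↑ˡ δ _ (B C) (map (oemb g) u) | antiB-↑ˡ δ _ (B M) u = presB g u
  ... | right u rewrite antipodalMap-↑ʳ (map (oemb g)) u = antiB-↑ʳ-cong δ (B C) (B M) (presB g u)

descentᴮ : ∀ {δ} → 1 ≤ δ → ∀ {M C} → IsMetricδ δ (sp M) → IsMetricδ δ (sp C) →
           (F : BEmb (antipodalB δ M) (antipodalB δ C)) →
           Σ[ φ ∈ BEmb M C ] img (map (oemb F)) ≡ double (img (map (oemb φ)))
descentᴮ {δ} δ≥1 {M} {C} metricM metricC F =
  record { oemb = descentEmb ; presB = φ-presB } , img-descent
  where
  open AntipodalDescent δ≥1 {sp M} {sp C} (proj₁ metricM) metricC (oemb F)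
  φ-presB : ∀ u → B C (φ u) ≡ B M u
  φ-presB u = begin
    B C (φ u)                                  ≡⟨ antiB-↑ˡ δ _ (B C) (φ u) ⟨
    antiB δ _ (B C) (φ u ↑ˡ bsize C)           ≡⟨ cong (antiB δ _ (B C)) (F-↑ˡ u) ⟨
    antiB δ _ (B C) (map (oemb F) (u ↑ˡ _))    ≡⟨ presB F _ ⟩
    antiB δ _ (B M) (u ↑ˡ bsize M)             ≡⟨ antiB-↑ˡ δ _ (B M) u ⟩
    B M u                                      ∎
    where open ≡-Reasoning

module BipartiteTransfer (δ : ℕ) (δ≥1 : 1 ≤ δ) = RamseyTransfer
  bsize BEmb (λ e → map (oemb e)) _∘ᴮ_ (λ _ _ _ → refl) idᴮ (λ _ → refl) inverseᴮ
  (antipodalB δ) double double-reflects-⊆ antipodalEmbᴮ (λ g → img-antipodalMap (map (oemb g)))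
  (λ M → IsMetricδ δ (sp M)) (descentᴮ δ≥1)

theorem7p4 : (δ : ℕ) → 3 ≤ δ →
    ((𝒦 : OSpace → Set) → (∀ M → 𝒦 M → IsMetricδ δ M) →
      RamseyO 𝒦 → RamseyO (AntiClassO δ 𝒦))
    × ((𝒦 : BSpace → Set) → (∀ M → 𝒦 M → IsBipMetricδ δ M) →
      RamseyB 𝒦 → RamseyB (AntiClassB δ 𝒦))
theorem7p4 δ 3≤δ =
    OrderedTransfer.ramsey-antiClass δ δ≥1
  , λ 𝒦 bipartite → BipartiteTransfer.ramsey-antiClass δ δ≥1 𝒦 (λ M 𝒦M → proj₁ (bipartite M 𝒦M))
  where
  δ≥1 : 1 ≤ δ
  δ≥1 = ℕ.≤-trans (s≤s z≤n) 3≤δ
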